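{- (a) For a term $b$ without unknowns, $\models\mathit{Tab}(b)$ iff $b=a(0,0,k)$ for some semitable $a(x,y,z)$. (b) For a term $b$ without unknowns, $\models\widetilde{\mathit{Tab}}(b)$ iff $b=a(\hat0,\tilde0,\tilde k)$ for some semitable $a(x,y,z)$.
   Context: First-order predicate calculus with identity $\doteq$ over a language with countably many variables and countably infinitely many function and predicate symbols of every arity; terms are variable-free; $\models\theta$ means $\theta$ is true in every structure; unknowns are distinguished constants. The language contains distinct constants $0,\hat0,\tilde0,k,\tilde k$ (not unknowns), a unary function symbol $S$ and a binary function symbol $\mathrm{pr}$; $S^0(t)=t$, $S^{m+1}(t)=S(S^m(t))$. Fix distinct variables $x,y,z$. Semitables are semiterms defined by: $z$ is a semitable (of length $0$); if $a(x,y,z)$ is a semitable of length $r$ and $p,q\ge0$, then $\mathrm{pr}(\mathrm{pr}(S^p(x),S^q(y)),a(x,y,z))$ is a semitable of length $r+1$. $\mathit{Tab}(x)$ is $0\doteq S(0)\wedge k\doteq\mathrm{pr}(\mathrm{pr}(0,0),k)\to k\doteq x$, and $\widetilde{\mathit{Tab}}(x)$ is $\hat0\doteq S(\hat0)\wedge\tilde0\doteq S(\tilde0)\wedge\tilde k\doteq\mathrm{pr}(\mathrm{pr}(\hat0,\tilde0),\tilde k)\to\tilde k\doteq x$. -}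

module Defs where

open import Data.Nat using (ℕ; zero; suc)
open import Data.Vec using (Vec; []; _∷_)
open import Data.Empty using (⊥)
open import Data.Product using (_×_)
open import Relation.Binary.PropositionalEquality using (_≡_)

-- Function symbols of arity n are indexed by ℕ (countably
-- infinitely many of each arity; constants are the arity-0 symbols).
-- Unknowns are distinguished constants, kept as a separate kind of
-- symbol (countably many, indexed by ℕ).

data Tm (V : Set) : Set where
  var : V → Tm V
  fn  : (n i : ℕ) → Vec (Tm V) n → Tm V
  unk : ℕ → Tm V

Term : Set
Term = Tm ⊥

Semiterm : Set
Semiterm = Tm ℕ

mutual
  data NoUnk {V : Set} : Tm V → Set where
    var : (v : V) → NoUnk (var v)
    fn  : (n i : ℕ) {ts : Vec (Tm V) n} → NoUnks ts → NoUnk (fn n i ts)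

  data NoUnks {V : Set} : {n : ℕ} → Vec (Tm V) n → Set where
    []  : NoUnks []
    _∷_ : {n : ℕ} {t : Tm V} {ts : Vec (Tm V) n} → NoUnk t → NoUnks ts → NoUnks (t ∷ ts)

c0 c0hat c0tilde ck cktilde : Term
c0      = fn 0 0 []
c0hat   = fn 0 1 []
c0tilde = fn 0 2 []
ck      = fn 0 3 []
cktilde = fn 0 4 []

S : {V : Set} → Tm V → Tm V
S t = fn 1 0 (t ∷ [])

pr : {V : Set} → Tm V → Tm V → Tm V
pr s t = fn 2 0 (s ∷ t ∷ [])

S^ : {V : Set} → ℕ → Tm V → Tm V
S^ zero    t = t
S^ (suc m) t = S (S^ m t)

vx vy vz : Semiterm
vx = var 0
vy = var 1
vz = var 2

data IsSemitable : Semiterm → Set where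
  base : IsSemitable vz
  step : {a : Semiterm} → IsSemitable a → (p q : ℕ) →
         IsSemitable (pr (pr (S^ p vx) (S^ q vy)) a)

-- a(t₁,t₂,t₃): substitute t₁,t₂,t₃ for x,y,z (other variables, which do
-- not occur in semitables, are sent to t₃).
mutual
  inst : Semiterm → Term → Term → Term → Term
  inst (var 0)             t₁ t₂ t₃ = t₁
  inst (var 1)             t₁ t₂ t₃ = t₂
  inst (var (suc (suc _))) t₁ t₂ t₃ = t₃
  inst (fn n i ts)         t₁ t₂ t₃ = fn n i (insts ts t₁ t₂ t₃)
  inst (unk u)             t₁ t₂ t₃ = unk u

  insts : {n : ℕ} → Vec Semiterm n → Term → Term → Term → Vec Term n
  insts []       t₁ t₂ t₃ = []
  insts (s ∷ ss) t₁ t₂ t₃ = inst s t₁ t₂ t₃ ∷ insts ss t₁ t₂ t₃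

record Structure : Set₁ where
  field
    Carrier : Set
    funI    : (n i : ℕ) → Vec Carrier n → Carrier
    unkI    : ℕ → Carrier
    predI   : (n i : ℕ) → Vec Carrier n → Set

open Structure

mutual
  ⟦_⟧ : Term → (M : Structure) → Carrier M
  ⟦ fn n i ts ⟧ M = funI M n i (⟦ ts ⟧s M)
  ⟦ unk u ⟧     M = unkI M u

  ⟦_⟧s : {n : ℕ} → Vec Term n → (M : Structure) → Vec (Carrier M) n
  ⟦ [] ⟧s     M = []
  ⟦ t ∷ ts ⟧s M = ⟦ t ⟧ M ∷ ⟦ ts ⟧s M

data Sentence : Set where
  _≐_ : Term → Term → Sentence
  _∧'_ : Sentence → Sentence → Sentence
  _⇒_ : Sentence → Sentence → Sentence

infix  6 _≐_
infixr 5 _∧'_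
infixr 4 _⇒_

_⊨_ : Structure → Sentence → Set
M ⊨ (s ≐ t)  = ⟦ s ⟧ M ≡ ⟦ t ⟧ M
M ⊨ (φ ∧' ψ) = (M ⊨ φ) × (M ⊨ ψ)
M ⊨ (φ ⇒ ψ)  = M ⊨ φ → M ⊨ ψ

⊨_ : Sentence → Set₁
⊨ θ = (M : Structure) → M ⊨ θ

Tab : Term → Sentence
Tab x = (c0 ≐ S c0 ∧' ck ≐ pr (pr c0 c0) ck) ⇒ ck ≐ x

Tab~ : Term → Sentence
Tab~ x = (c0hat ≐ S c0hat ∧' c0tilde ≐ S c0tilde ∧'
          cktilde ≐ pr (pr c0hat c0tilde) cktilde) ⇒ cktilde ≐ x

module Submission where

-- Both parts of the lemma are instances of one statement about three
-- constants X, Y, K with K different from X and Y (X = Y is allowed):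
--
--   b is forced to equal K in every structure where S X = X, S Y = Y and
--   pr (pr X Y) K = K   iff   b = a(X,Y,K) for some semitable a.
--
-- Soundness ("if"): in such a structure S^p X and S^p Y evaluate like X
-- and Y, so by induction on the semitable every instance a(X,Y,K)
-- evaluates to K.
-- Completeness ("only if"): the closed terms form a structure in which
-- S and pr are interpreted by one-step normalisation with respect to the
-- three equations (S X ↦ X, S Y ↦ Y, pr (pr X Y) K ↦ K).  It satisfies
-- the hypotheses, so a forced b evaluates there to K, and inverting the
-- evaluation (constants, then the pair pr X Y, then K) reads off a
-- semitable.  Part (a) is the instance X = Y = 0, K = k (the duplicated
-- hypothesis S 0 = 0 is dropped), part (b) the instance X = 0̂, Y = 0̃,
-- K = k̃.

open import Defs
open import Data.Product using (_×_; Σ; _,_)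
open import Data.Sum using (_⊎_; inj₁; inj₂)
open import Data.Empty using (⊥; ⊥-elim)
open import Data.Unit using (⊤)
open import Data.Nat using (ℕ; zero; suc) renaming (_≟_ to _≟ℕ_)
open import Data.Vec using (Vec; []; _∷_)
open import Function.Bundles using (_⇔_; mk⇔)
open import Function.Properties.Equivalence using () renaming (trans to ⇔-trans)
open import Relation.Binary.Definitions using (DecidableEquality)
open import Relation.Nullary using (yes; no)
open import Relation.Nullary.Decidable using (map′; _×-dec_; _⊎-dec_)
open import Relation.Binary.PropositionalEquality
  using (_≡_; _≢_; refl; sym; trans; cong; cong₂; module ≡-Reasoning)

open Structure

inst-S^ : ∀ p (s : Semiterm) (t₁ t₂ t₃ : Term) →
          inst (S^ p s) t₁ t₂ t₃ ≡ S^ p (inst s t₁ t₂ t₃)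
inst-S^ zero    s t₁ t₂ t₃ = refl
inst-S^ (suc p) s t₁ t₂ t₃ = cong S (inst-S^ p s t₁ t₂ t₃)

-- Equality of closed terms is decidable; the term model below needs it
-- to recognise the left-hand sides of the three equations.
mutual
  _≟_ : DecidableEquality Term
  var () ≟ _
  fn n i ts ≟ fn m j us with n ≟ℕ m | i ≟ℕ j
  ... | yes refl | yes refl = map′ (cong (fn n i)) (λ { refl → refl }) (ts ≟s us)
  ... | yes refl | no i≢j   = no λ { refl → i≢j refl }
  ... | no n≢m   | _        = no λ { refl → n≢m refl }
  fn n i ts ≟ unk v  = no λ ()
  unk u ≟ fn m j us  = no λ ()
  unk u ≟ unk v      = map′ (cong unk) (λ { refl → refl }) (u ≟ℕ v)

  _≟s_ : {n : ℕ} → DecidableEquality (Vec Term n)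
  [] ≟s [] = yes refl
  (t ∷ ts) ≟s (u ∷ us) =
    map′ (λ { (refl , refl) → refl }) (λ { refl → refl , refl }) ((t ≟ u) ×-dec (ts ≟s us))

C : ℕ → Term
C j = fn 0 j []

C-injective : ∀ {i j} → C i ≡ C j → i ≡ j
C-injective refl = refl

module Tabulation (ix iy ik : ℕ) (ix≢ik : ix ≢ ik) (iy≢ik : iy ≢ ik) where

  X Y K : Term
  X = C ix
  Y = C iy
  K = C ik

  TableModel : Structure → Set
  TableModel M = (⟦ X ⟧ M ≡ ⟦ S X ⟧ M) × (⟦ Y ⟧ M ≡ ⟦ S Y ⟧ M)
               × (⟦ K ⟧ M ≡ ⟦ pr (pr X Y) K ⟧ M)

  Forced : Term → Set₁
  Forced b = (M : Structure) → TableModel M → ⟦ K ⟧ M ≡ ⟦ b ⟧ M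

  SemitableInstance : Term → Set
  SemitableInstance b = Σ Semiterm λ a → IsSemitable a × (b ≡ inst a X Y K)

  S^-fixed : (M : Structure) (p : ℕ) (t : Term) →
             ⟦ t ⟧ M ≡ ⟦ S t ⟧ M → ⟦ S^ p t ⟧ M ≡ ⟦ t ⟧ M
  S^-fixed M zero    t fix = refl
  S^-fixed M (suc p) t fix = trans (cong (λ u → funI M 1 0 (u ∷ [])) (S^-fixed M p t fix)) (sym fix)

  semitable-sound : (M : Structure) → TableModel M →
                    ∀ {a} → IsSemitable a → ⟦ inst a X Y K ⟧ M ≡ ⟦ K ⟧ M
  semitable-sound M model base = refl
  semitable-sound M model@(fixX , fixY , fixK) (step {a} sa p q) = begin
      ⟦ pr (pr (inst (S^ p vx) X Y K) (inst (S^ q vy) X Y K)) (inst a X Y K) ⟧ M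
    ≡⟨ cong₂ (λ u v → ⟦ pr (pr u v) (inst a X Y K) ⟧ M) (inst-S^ p vx X Y K) (inst-S^ q vy X Y K) ⟩
      ⟦ pr (pr (S^ p X) (S^ q Y)) (inst a X Y K) ⟧ M
    ≡⟨ cong₂ (λ u v → pair (pair u v) (⟦ inst a X Y K ⟧ M)) (S^-fixed M p X fixX) (S^-fixed M q Y fixY) ⟩
      pair (⟦ pr X Y ⟧ M) (⟦ inst a X Y K ⟧ M)
    ≡⟨ cong (pair (⟦ pr X Y ⟧ M)) (semitable-sound M model sa) ⟩
      ⟦ pr (pr X Y) K ⟧ M
    ≡⟨ sym fixK ⟩
      ⟦ K ⟧ M
    ∎
    where
    open ≡-Reasoning
    pair : Carrier M → Carrier M → Carrier M
    pair u v = funI M 2 0 (u ∷ v ∷ [])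

  applyS : Term → Term
  applyS t with (t ≟ X) ⊎-dec (t ≟ Y)
  ... | yes _ = t
  ... | no  _ = S t

  applyPr : Term → Term → Term
  applyPr s t with (s ≟ pr X Y) ×-dec (t ≟ K)
  ... | yes _ = K
  ... | no  _ = pr s t

  interpret : (n i : ℕ) → Vec Term n → Term
  interpret 1 0 (t ∷ [])     = applyS t
  interpret 2 0 (s ∷ t ∷ []) = applyPr s t
  interpret n i ts           = fn n i ts

  termModel : Structure
  termModel = record { Carrier = Term ; funI = interpret ; unkI = unk ; predI = λ _ _ _ → ⊤ }

  nf : Term → Term
  nf t = ⟦ t ⟧ termModel

  termModel-table : TableModel termModel
  termModel-table = fixes X (inj₁ refl) , fixes Y (inj₂ refl) , fires
    where
    fixes : ∀ t → (t ≡ X) ⊎ (t ≡ Y) → t ≡ applyS t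
    fixes t t∈XY with (t ≟ X) ⊎-dec (t ≟ Y)
    ... | yes _     = refl
    ... | no  t∉XY  = ⊥-elim (t∉XY t∈XY)
    fires : K ≡ applyPr (applyPr X Y) K
    fires with (X ≟ pr X Y) ×-dec (Y ≟ K)
    ... | yes (() , _)
    ... | no _ with (pr X Y ≟ pr X Y) ×-dec (K ≟ K)
    ...   | yes _     = refl
    ...   | no ¬redex = ⊥-elim (¬redex (refl , refl))

  applyS-const : ∀ t {j} → applyS t ≡ C j → (t ≡ C j) × ((C j ≡ X) ⊎ (C j ≡ Y))
  applyS-const t e with (t ≟ X) ⊎-dec (t ≟ Y)
  applyS-const t refl | yes t∈XY = refl , t∈XY
  applyS-const t ()   | no _

  applyS-not-pair : ∀ t {u v} → applyS t ≢ pr u v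
  applyS-not-pair t with (t ≟ X) ⊎-dec (t ≟ Y)
  ... | yes (inj₁ refl) = λ ()
  ... | yes (inj₂ refl) = λ ()
  ... | no  _           = λ ()

  applyPr-const : ∀ s t {j} → applyPr s t ≡ C j → (j ≡ ik) × (s ≡ pr X Y) × (t ≡ K)
  applyPr-const s t e with (s ≟ pr X Y) ×-dec (t ≟ K)
  applyPr-const s t refl | yes redex = refl , redex
  applyPr-const s t ()   | no _

  applyPr-pair : ∀ s t {u v} → applyPr s t ≡ pr u v → (s ≡ u) × (t ≡ v)
  applyPr-pair s t e with (s ≟ pr X Y) ×-dec (t ≟ K)
  applyPr-pair s t () | yes _
  applyPr-pair s t refl | no _ = refl , refl

  K≢X⊎Y : (K ≡ X) ⊎ (K ≡ Y) → ⊥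
  K≢X⊎Y (inj₁ K≡X) = ix≢ik (sym (C-injective K≡X))
  K≢X⊎Y (inj₂ K≡Y) = iy≢ik (sym (C-injective K≡Y))

  nf-const : ∀ {j} → j ≢ ik → ∀ b → nf b ≡ C j → Σ ℕ λ p → b ≡ S^ p (C j)
  nf-const j≢k (var ())
  nf-const j≢k (fn 0 i []) refl = 0 , refl
  nf-const j≢k (fn 1 0 (t ∷ [])) e with applyS-const (nf t) e
  ... | t↦Cj , _ with nf-const j≢k t t↦Cj
  ...   | p , t≡S^p = suc p , cong S t≡S^p
  nf-const j≢k (fn 1 (suc i) ts) ()
  nf-const j≢k (fn 2 0 (s ∷ t ∷ [])) e with applyPr-const (nf s) (nf t) e
  ... | j≡k , _ = ⊥-elim (j≢k j≡k)
  nf-const j≢k (fn 2 (suc i) ts) ()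
  nf-const j≢k (fn (suc (suc (suc n))) i ts) ()
  nf-const j≢k (unk u) ()

  nf-pair : ∀ b → nf b ≡ pr X Y → Σ ℕ λ p → Σ ℕ λ q → b ≡ pr (S^ p X) (S^ q Y)
  nf-pair (var ())
  nf-pair (fn 0 i []) ()
  nf-pair (fn 1 0 (t ∷ [])) e = ⊥-elim (applyS-not-pair (nf t) e)
  nf-pair (fn 1 (suc i) ts) ()
  nf-pair (fn 2 0 (s ∷ t ∷ [])) e with applyPr-pair (nf s) (nf t) e
  ... | s↦X , t↦Y with nf-const ix≢ik s s↦X | nf-const iy≢ik t t↦Y
  ...   | p , s≡S^pX | q , t≡S^qY = p , q , cong₂ pr s≡S^pX t≡S^qY
  nf-pair (fn 2 (suc i) ts) ()
  nf-pair (fn (suc (suc (suc n))) i ts) ()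
  nf-pair (unk u) ()

  nf-K : ∀ b → nf b ≡ K → SemitableInstance b
  nf-K (var ())
  nf-K (fn 0 i []) refl = vz , base , refl
  nf-K (fn 1 0 (t ∷ [])) e with applyS-const (nf t) e
  ... | _ , K∈XY = ⊥-elim (K≢X⊎Y K∈XY)
  nf-K (fn 1 (suc i) ts) ()
  nf-K (fn 2 0 (s ∷ t ∷ [])) e with applyPr-const (nf s) (nf t) e
  ... | _ , s↦XY , t↦K with nf-pair s s↦XY | nf-K t t↦K
  ...   | p , q , s≡pair | a , sa , t≡a =
    pr (pr (S^ p vx) (S^ q vy)) a , step sa p q ,
    cong₂ pr (trans s≡pair (cong₂ pr (sym (inst-S^ p vx X Y K)) (sym (inst-S^ q vy X Y K)))) t≡a
  nf-K (fn 2 (suc i) ts) ()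
  nf-K (fn (suc (suc (suc n))) i ts) ()
  nf-K (unk u) ()

  forced⇔semitable : ∀ b → Forced b ⇔ SemitableInstance b
  forced⇔semitable b = mk⇔
    (λ forced → nf-K b (sym (forced termModel termModel-table)))
    (λ { (a , sa , refl) M model → sym (semitable-sound M model sa) })

module TabA = Tabulation 0 0 3 (λ ()) (λ ())

-- Tab has the hypothesis S 0 = 0 once, a table model for X = Y has it twice.
Tab⇔forced : ∀ b → (⊨ Tab b) ⇔ TabA.Forced b
Tab⇔forced b = mk⇔
  (λ valid M (fix0 , _ , fixK) → valid M (fix0 , fixK))
  (λ forced M (fix0 , fixK) → forced M (fix0 , fix0 , fixK))

module TabB = Tabulation 1 2 4 (λ ()) (λ ())

lemma5p11 : ((b : Term) → NoUnk b →
               (⊨ Tab b) ⇔ Σ Semiterm (λ a → IsSemitable a × (b ≡ inst a c0 c0 ck)))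
            × ((b : Term) → NoUnk b →
               (⊨ Tab~ b) ⇔ Σ Semiterm (λ a → IsSemitable a × (b ≡ inst a c0hat c0tilde cktilde)))
lemma5p11 =
  (λ b _ → ⇔-trans (Tab⇔forced b) (TabA.forced⇔semitable b)) ,
  (λ b _ → TabB.forced⇔semitable b)
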